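{- The cost of a partial mutual search algorithm $T$ equals the cost of the partial algorithm that results from $T$ by retiring the edge $e$ (among the not yet retired edges) of minimum retiring cost.
   Context: Mutual search with two agents on $n$ sites $V=\{0,\ldots,n-1\}$ in the synchronous model. A (total) algorithm is an ordered tournament $T=(V,E,\prec)$: $E$ contains exactly one directed edge (query) between every pair of sites, and $\prec$ is a total order on $E$ (the time order of queries). Row $E_i$ is the set of outgoing edges of node $i$. The cost of an edge $e=(i,j)$ is $|E_i^{\prec e}|+1+|E_j^{\prec e}|$, where $F^{\prec e}=\{f\in F: f\prec e\}$, and the cost of a total algorithm is the maximum edge cost. A partial algorithm is a partially ordered tournament $T=(V,E,\prec,R)$ where $R\subseteq E$ is the set of retired edges, and $\prec$ totally orders $R$, orders all of $E-R$ before all of $R$, and leaves $E-R$ pairwise unordered. An edge $e=(i,j)\in E-R$ has retiring cost $c(e)=|E_i-R|+|E_j-R|$. Retiring $e$ yields the refined partial algorithm $(V,E,\prec',R')$ with $R'=R\cup\{e\}$ and $\prec'=\prec\cup\{(f,e): f\in E-R'\}$ (so $e$ becomes the earliest retired edge). Any sequence of $|E-R|$ retirements yields a total algorithm, called a total refinement of $T$; the retiring cost of an edge equals its cost in any total refinement after it is retired. The cost of a partial algorithm $T$ is the minimal cost among all its total refinements. -}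

module Defs where

open import Data.Nat using (ℕ; _+_; _⊔_; _≤_)
open import Data.Fin using (Fin)
import Data.Fin.Properties as FinP
open import Data.Product using (_×_; _,_; proj₁; proj₂; Σ; ∃)
open import Data.Product.Properties using (≡-dec)
open import Data.List using (List; []; _∷_; _++_; [_]; length; filter; foldr)
open import Data.List.Relation.Unary.All using (All)
open import Data.List.Relation.Unary.Unique.Propositional using (Unique)
open import Data.List.Membership.Propositional using (_∈_; _∉_)
import Data.List.Membership.DecPropositional as DecMem
open import Relation.Binary.PropositionalEquality using (_≡_; _≢_)
open import Relation.Binary.Definitions using (DecidableEquality)
open import Relation.Nullary using (¬_)
open import Relation.Nullary.Decidable using (¬?)
open import Data.Sum using (_⊎_)

-- A directed edge (query) (i , j) : site i queries site j.
Edge : ℕ → Set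
Edge n = Fin n × Fin n

_≟E_ : ∀ {n} → DecidableEquality (Edge n)
_≟E_ = ≡-dec FinP._≟_ FinP._≟_

record Tournament (n : ℕ) : Set where
  field
    edges     : List (Edge n)
    unique    : Unique edges
    irrefl    : ∀ {i j} → (i , j) ∈ edges → i ≢ j
    asym      : ∀ {i j} → (i , j) ∈ edges → (j , i) ∉ edges
    complete  : ∀ {i j} → i ≢ j → (i , j) ∈ edges ⊎ (j , i) ∈ edges
open Tournament public

-- A partial algorithm (V,E,≺,R): the tournament together with the list of
-- retired edges R in their time order ≺ (earliest first).  The edges of E - R
-- are pairwise unordered and all precede R.
record PartialAlg (n : ℕ) : Set where
  field
    tour       : Tournament n
    retired    : List (Edge n)
    retUnique  : Unique retired
    retInE     : All (_∈ edges tour) retired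
open PartialAlg public

retire : ∀ {n} → PartialAlg n → Edge n → List (Edge n)
retire A e = e ∷ retired A

outdeg : ∀ {n} → Fin n → List (Edge n) → ℕ
outdeg i F = length (filter (λ f → proj₁ f FinP.≟ i) F)

unretired : ∀ {n} → PartialAlg n → List (Edge n)
unretired A = filter (λ f → ¬? (DecMem._∈?_ _≟E_ f (retired A))) (edges (tour A))

retCost : ∀ {n} → PartialAlg n → Edge n → ℕ
retCost A (i , j) = outdeg i (unretired A) + outdeg j (unretired A)

edgeCosts : ∀ {n} → List (Edge n) → List (Edge n) → List ℕ
edgeCosts pre [] = []
edgeCosts pre ((i , j) ∷ rest) =
  (outdeg i pre + 1 + outdeg j pre) ∷ edgeCosts (pre ++ [ (i , j) ]) rest

totalCost : ∀ {n} → List (Edge n) → ℕ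
totalCost L = foldr _⊔_ 0 (edgeCosts [] L)

data TotalRefinement {n : ℕ} (T : Tournament n) : List (Edge n) → List (Edge n) → Set where
  done : ∀ {R} → (∀ {f} → f ∈ edges T → f ∈ R) → TotalRefinement T R R
  step : ∀ {R L e} → e ∈ edges T → e ∉ R →
         TotalRefinement T (e ∷ R) L → TotalRefinement T R L

IsCostFrom : ∀ {n} → Tournament n → List (Edge n) → ℕ → Set
IsCostFrom T R c =
  (Σ (List _) λ L → TotalRefinement T R L × totalCost L ≡ c) ×
  (∀ L → TotalRefinement T R L → c ≤ totalCost L)

IsCost : ∀ {n} → PartialAlg n → ℕ → Set
IsCost A c = IsCostFrom (tour A) (retired A) c

module Submission where

-- Every total refinement queries the pending edges E - R in some order P and
-- then R.  Postponing the cheapest pending edge e to the end of P, i.e.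
-- retiring it first, does not increase the cost: the edges it overtakes only
-- get cheaper, the edges of R see the same outdegrees before them, and e
-- itself now costs exactly c(e).  That is at most c(g) for the last edge g of
-- P, which is also the cost of g in the original order, since g is preceded
-- there by all other pending edges.

open import Defs
open import Data.Nat using (ℕ; _≤_; _+_; z≤n)
open import Data.List.Membership.Propositional using (_∈_; _∉_)
open import Function.Bundles using (_⇔_; mk⇔)

open import Data.Nat.Properties
  using (≤-refl; ≤-trans; ≤-reflexive; ≤-antisym; +-mono-≤; +-monoˡ-≤; m≤m+n; +-identityʳ;
         ⊔-lub; m⊔n≤o⇒m≤o; m⊔n≤o⇒n≤o; module ≤-Reasoning)
open import Data.Fin using (Fin)
import Data.Fin.Properties as FinP
open import Data.Product using (_×_; _,_; proj₁; proj₂; ∃-syntax; Σ-syntax)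
open import Data.List using (List; []; _∷_; _++_; [_]; _∷ʳ_; length; filter)
open import Data.List.Properties using (filter-++; filter-none; length-++; ++-assoc; ++-identityʳ; foldr-preservesᵇ; foldr-forcesᵇ)
open import Data.List.Reverse using (Reverse; []; _∶_∶ʳ_; reverseView)
open import Data.List.Relation.Unary.All as All using (All; _∷_)
open import Data.List.Relation.Unary.Any using (here; there)
open import Data.List.Relation.Unary.AllPairs using (_∷_)
import Data.List.Relation.Unary.Unique.Propositional.Properties as Unique
open import Data.List.Relation.Binary.Permutation.Propositional
  using (_↭_; prep; swap; ↭-refl; ↭-sym; ↭-trans; ↭-reflexive)
open import Data.List.Relation.Binary.Permutation.Propositional.Properties
  using (∈-resp-↭; ↭-length; filter-↭; ++⁺ˡ; shift; drop-∷; ∷↭∷ʳ)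
open import Data.List.Relation.Binary.BagAndSetEquality using (∼bag⇒↭)
open import Data.List.Membership.Propositional.Properties using (∉[]; ∈-++⁺ʳ; ∈-∃++; ∈-filter⁺; ∈-filter⁻)
open import Data.List.Membership.Propositional.Properties.WithK using (unique∧set⇒bag)
import Data.List.Membership.DecPropositional as DecMem
open import Data.Empty using (⊥-elim)
open import Relation.Binary.PropositionalEquality using (_≡_; _≢_; refl; sym; trans; cong; cong₂; subst; module ≡-Reasoning)
open import Relation.Nullary using (yes; no)
open import Relation.Nullary.Decidable using (¬?; decidable-stable)
open import Relation.Unary using (Decidable)

module _ {n : ℕ} where

  private
    E = Edge n
  open DecMem (_≟E_ {n}) using (_∈?_)

  outdeg-++ : ∀ i (xs ys : List E) → outdeg i (xs ++ ys) ≡ outdeg i xs + outdeg i ys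
  outdeg-++ i xs ys = trans (cong length (filter-++ _ xs ys)) (length-++ (filter _ xs))

  outdeg-↭ : ∀ i {xs ys : List E} → xs ↭ ys → outdeg i xs ≡ outdeg i ys
  outdeg-↭ i p = ↭-length (filter-↭ _ p)

  outdeg-source : ∀ (i j : Fin n) → outdeg i [ (i , j) ] ≡ 1
  outdeg-source i j with i FinP.≟ i
  ... | yes _ = refl
  ... | no i≢i = ⊥-elim (i≢i refl)

  outdeg-target : ∀ {i j : Fin n} → i ≢ j → outdeg j [ (i , j) ] ≡ 0
  outdeg-target {i} {j} i≢j with i FinP.≟ j
  ... | yes i≡j = ⊥-elim (i≢j i≡j)
  ... | no _ = refl

  infix 4 _≼_

  record _≼_ (xs ys : List E) : Set where
    constructor outdeg-≤
    field ≤-at : ∀ i → outdeg i xs ≤ outdeg i ys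
  open _≼_

  ↭⇒≼ : ∀ {xs ys : List E} → xs ↭ ys → xs ≼ ys
  ↭⇒≼ p = outdeg-≤ λ i → ≤-reflexive (outdeg-↭ i p)

  xs≼xs++ys : ∀ (xs ys : List E) → xs ≼ xs ++ ys
  xs≼xs++ys xs ys = outdeg-≤ λ i → subst (outdeg i xs ≤_) (sym (outdeg-++ i xs ys)) (m≤m+n _ _)

  ∷ʳ-mono-≼ : ∀ {xs ys : List E} x → xs ≼ ys → xs ∷ʳ x ≼ ys ∷ʳ x
  ∷ʳ-mono-≼ {xs} {ys} x h = outdeg-≤ λ i → begin
    outdeg i (xs ∷ʳ x)          ≡⟨ outdeg-++ i xs [ x ] ⟩
    outdeg i xs + outdeg i [ x ] ≤⟨ +-monoˡ-≤ (outdeg i [ x ]) (≤-at h i) ⟩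
    outdeg i ys + outdeg i [ x ] ≡⟨ outdeg-++ i ys [ x ] ⟨
    outdeg i (ys ∷ʳ x)          ∎
    where open ≤-Reasoning

  edgeCost : List E → E → ℕ
  edgeCost pre (i , j) = outdeg i pre + 1 + outdeg j pre

  edgeCost-mono : ∀ {pre pre'} (f : E) → pre ≼ pre' → edgeCost pre f ≤ edgeCost pre' f
  edgeCost-mono (i , j) h = +-mono-≤ (+-monoˡ-≤ 1 (≤-at h i)) (≤-at h j)

  edgeCost-∷ʳ : ∀ (pre : List E) {i j} → i ≢ j →
    edgeCost pre (i , j) ≡ outdeg i (pre ∷ʳ (i , j)) + outdeg j (pre ∷ʳ (i , j))
  edgeCost-∷ʳ pre {i} {j} i≢j = begin
    outdeg i pre + 1 + outdeg j pre
      ≡⟨ cong₂ (λ a b → outdeg i pre + a + b) (sym (outdeg-source i j)) (sym (+-identityʳ _)) ⟩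
    outdeg i pre + outdeg i [ (i , j) ] + (outdeg j pre + 0)
      ≡⟨ cong (λ b → outdeg i pre + outdeg i [ (i , j) ] + (outdeg j pre + b)) (sym (outdeg-target i≢j)) ⟩
    outdeg i pre + outdeg i [ (i , j) ] + (outdeg j pre + outdeg j [ (i , j) ])
      ≡⟨ sym (cong₂ _+_ (outdeg-++ i pre _) (outdeg-++ j pre _)) ⟩
    outdeg i (pre ∷ʳ (i , j)) + outdeg j (pre ∷ʳ (i , j)) ∎
    where open ≡-Reasoning

  CostsWithin : ℕ → List E → List E → Set
  CostsWithin B pre xs = All (_≤ B) (edgeCosts pre xs)

  CostsWithin-mono : ∀ {B pre pre'} xs → pre ≼ pre' → CostsWithin B pre' xs → CostsWithin B pre xs
  CostsWithin-mono []       h _        = All.[]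
  CostsWithin-mono (x ∷ xs) h (c ∷ cs) =
    ≤-trans (edgeCost-mono x h) c ∷ CostsWithin-mono xs (∷ʳ-mono-≼ x h) cs

  totalCost≤⇒CostsWithin : ∀ {B} (L : List E) → totalCost L ≤ B → CostsWithin B [] L
  totalCost≤⇒CostsWithin L =
    foldr-forcesᵇ (λ x y h → m⊔n≤o⇒m≤o x y h , m⊔n≤o⇒n≤o x y h) 0 (edgeCosts [] L)

  CostsWithin⇒totalCost≤ : ∀ {B} (L : List E) → CostsWithin B [] L → totalCost L ≤ B
  CostsWithin⇒totalCost≤ L = foldr-preservesᵇ ⊔-lub z≤n

  CostsWithin-lookup : ∀ {B pre f} xs {ys} → CostsWithin B pre ((xs ∷ʳ f) ++ ys) →
    edgeCost (pre ++ xs) f ≤ B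
  CostsWithin-lookup {B} {pre} {f} [] (c ∷ _) =
    subst (λ p → edgeCost p f ≤ B) (sym (++-identityʳ pre)) c
  CostsWithin-lookup {B} {pre} {f} (x ∷ xs) (_ ∷ cs) =
    subst (λ p → edgeCost p f ≤ B) (++-assoc pre [ x ] xs) (CostsWithin-lookup xs cs)

  CostsWithin-postpone : ∀ {B pre f zs} xs ys →
    CostsWithin B pre ((xs ++ f ∷ ys) ++ zs) → edgeCost (pre ++ xs ++ ys) f ≤ B →
    CostsWithin B pre ((xs ++ ys) ++ f ∷ zs)
  CostsWithin-postpone {B} {pre} {f} (x ∷ xs) ys (c ∷ cs) cf =
    c ∷ CostsWithin-postpone xs ys cs (subst (λ p → edgeCost p f ≤ B) (sym (++-assoc pre [ x ] (xs ++ ys))) cf)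
  CostsWithin-postpone [] [] cs cf = cs
  CostsWithin-postpone {B} {pre} {f} {zs} [] (y ∷ ys) (_ ∷ cy ∷ cs) cf =
    ≤-trans (edgeCost-mono y (xs≼xs++ys pre [ f ])) cy ∷
    CostsWithin-postpone [] ys (cf-y ∷ CostsWithin-mono (ys ++ zs) (↭⇒≼ swap-last) cs) cf-ys
    where
    cf-ys : edgeCost ((pre ∷ʳ y) ++ ys) f ≤ B
    cf-ys = subst (λ p → edgeCost p f ≤ B) (sym (++-assoc pre [ y ] ys)) cf
    cf-y : edgeCost (pre ∷ʳ y) f ≤ B
    cf-y = ≤-trans (edgeCost-mono f (xs≼xs++ys (pre ∷ʳ y) ys)) cf-ys
    swap-last : (pre ∷ʳ y) ∷ʳ f ↭ (pre ∷ʳ f) ∷ʳ y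
    swap-last = ↭-trans (↭-reflexive (++-assoc pre [ y ] [ f ]))
               (↭-trans (++⁺ˡ pre (swap y f ↭-refl)) (↭-reflexive (sym (++-assoc pre [ f ] [ y ]))))

  ∉? : (R : List E) → Decidable (_∉ R)
  ∉? R f = ¬? (f ∈? R)

  -- unretired A is definitionally pending (tour A) (retired A).
  pending : Tournament n → List E → List E
  pending T R = filter (∉? R) (edges T)

  ∈-pending⁺ : ∀ {T R f} → f ∈ edges T → f ∉ R → f ∈ pending T R
  ∈-pending⁺ {R = R} = ∈-filter⁺ (∉? R)

  ∈-pending⁻ : ∀ {T R f} → f ∈ pending T R → f ∈ edges T × f ∉ R
  ∈-pending⁻ {R = R} = ∈-filter⁻ (∉? R)

  pending-retire : ∀ {T R e} → e ∈ edges T → e ∉ R → pending T R ↭ e ∷ pending T (e ∷ R)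
  pending-retire {T} {R} {e} e∈ e∉ =
    ∼bag⇒↭ (unique∧set⇒bag (Unique.filter⁺ (∉? R) (unique T))
      (e∉pending ∷ Unique.filter⁺ (∉? (e ∷ R)) (unique T))
      (mk⇔ to from))
    where
    e∉pending : All (e ≢_) (pending T (e ∷ R))
    e∉pending = All.tabulate λ f∈ e≡f → proj₂ (∈-pending⁻ {T} {e ∷ R} f∈) (here (sym e≡f))
    to : ∀ {f} → f ∈ pending T R → f ∈ e ∷ pending T (e ∷ R)
    to {f} f∈ with f ≟E e
    ... | yes refl = here refl
    ... | no f≢e = let f∈E , f∉R = ∈-pending⁻ {T} {R} f∈ in
      there (∈-pending⁺ {T} {e ∷ R} f∈E λ { (here f≡e) → f≢e f≡e ; (there f∈R) → f∉R f∈R })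
    from : ∀ {f} → f ∈ e ∷ pending T (e ∷ R) → f ∈ pending T R
    from (here refl) = ∈-pending⁺ {T} {R} e∈ e∉
    from (there f∈) = let f∈E , f∉eR = ∈-pending⁻ {T} {e ∷ R} f∈ in
      ∈-pending⁺ {T} {R} f∈E (λ f∈R → f∉eR (there f∈R))

  -- Retiring prepends to R, so a total refinement of (T, R) is some ordering P
  -- of E - R (the first retired edge last) followed by R.
  module _ {T : Tournament n} where

    refinement⇒schedule : ∀ {R L} → TotalRefinement T R L → ∃[ P ] P ↭ pending T R × L ≡ P ++ R
    refinement⇒schedule {R} (done all∈R) =
      [] , ↭-reflexive (sym (filter-none (∉? R) (All.tabulate λ f∈E f∉R → f∉R (all∈R f∈E)))) , refl
    refinement⇒schedule {R} (step {e = e} e∈ e∉ r) with refinement⇒schedule r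
    ... | P , P↭ , refl =
      P ∷ʳ e ,
      ↭-trans (↭-sym (∷↭∷ʳ e P)) (↭-trans (prep e P↭) (↭-sym (pending-retire {T} {R} e∈ e∉))) ,
      sym (++-assoc P [ e ] R)

    schedule⇒refinement : ∀ {R} P → P ↭ pending T R → TotalRefinement T R (P ++ R)
    schedule⇒refinement P = go (reverseView P)
      where
      go : ∀ {R P} → Reverse P → P ↭ pending T R → TotalRefinement T R (P ++ R)
      go {R} [] P↭ = done λ {f} f∈E →
        decidable-stable (f ∈? R)
          λ f∉R → ∉[] (∈-resp-↭ (↭-sym P↭) (∈-pending⁺ {T} {R} f∈E f∉R))
      go {R} (P ∶ v ∶ʳ e) P↭ =
        subst (TotalRefinement T R) (sym (++-assoc P [ e ] R)) (step e∈ e∉ (go v P↭′))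
        where
        e∈pending = ∈-resp-↭ P↭ (∈-++⁺ʳ P (here refl))
        e∈ = proj₁ (∈-pending⁻ {T} {R} e∈pending)
        e∉ = proj₂ (∈-pending⁻ {T} {R} e∈pending)
        P↭′ : P ↭ pending T (e ∷ R)
        P↭′ = drop-∷ (↭-trans (∷↭∷ʳ e P) (↭-trans P↭ (pending-retire {T} {R} e∈ e∉)))

module _ {n : ℕ} (A : PartialAlg n) where

  private
    T = tour A
    R = retired A

  edgeCost≡retCost : ∀ {P f} → P ∷ʳ f ↭ unretired A → f ∈ edges T → edgeCost P f ≡ retCost A f
  edgeCost≡retCost {P} {i , j} P↭ f∈ =
    trans (edgeCost-∷ʳ P (irrefl T f∈)) (cong₂ _+_ (outdeg-↭ i P↭) (outdeg-↭ j P↭))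

  module _ {e : Edge n} (e∈ : e ∈ edges T) (e∉ : e ∉ R)
           (cheapest : ∀ f → f ∈ edges T → f ∉ R → retCost A e ≤ retCost A f) where

    retCost≤totalCost : ∀ P → P ↭ unretired A → retCost A e ≤ totalCost (P ++ R)
    retCost≤totalCost P P↭ with reverseView P
    ... | [] = ⊥-elim (∉[] (∈-resp-↭ (↭-sym P↭) (∈-pending⁺ {T = T} {R = R} e∈ e∉)))
    ... | P₀ ∶ _ ∶ʳ g = begin
      retCost A e     ≤⟨ cheapest g g∈ g∉ ⟩
      retCost A g     ≡⟨ edgeCost≡retCost P↭ g∈ ⟨
      edgeCost P₀ g   ≤⟨ CostsWithin-lookup P₀ (totalCost≤⇒CostsWithin (P ++ R) ≤-refl) ⟩
      totalCost (P ++ R) ∎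
      where
      open ≤-Reasoning
      g∈pending = ∈-resp-↭ P↭ (∈-++⁺ʳ P₀ (here refl))
      g∈ = proj₁ (∈-pending⁻ {T = T} {R = R} g∈pending)
      g∉ = proj₂ (∈-pending⁻ {T = T} {R = R} g∈pending)

    retire-cheapest : ∀ {L} → TotalRefinement T R L →
      Σ[ L′ ∈ List (Edge n) ] TotalRefinement T (e ∷ R) L′ × totalCost L′ ≤ totalCost L
    retire-cheapest r with refinement⇒schedule r
    ... | P , P↭ , refl with ∈-∃++ (∈-resp-↭ (↭-sym P↭) (∈-pending⁺ {T = T} {R = R} e∈ e∉))
    ... | X , Y , refl =
      (X ++ Y) ++ e ∷ R ,
      schedule⇒refinement (X ++ Y) XY↭ ,
      CostsWithin⇒totalCost≤ _ (CostsWithin-postpone X Y (totalCost≤⇒CostsWithin _ ≤-refl) e-cost)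
      where
      e∷XY↭ : e ∷ X ++ Y ↭ unretired A
      e∷XY↭ = ↭-trans (↭-sym (shift e X Y)) P↭
      XY↭ : X ++ Y ↭ pending T (e ∷ R)
      XY↭ = drop-∷ (↭-trans e∷XY↭ (pending-retire {T = T} {R = R} e∈ e∉))
      e-cost : edgeCost (X ++ Y) e ≤ totalCost ((X ++ e ∷ Y) ++ R)
      e-cost = begin
        edgeCost (X ++ Y) e             ≡⟨ edgeCost≡retCost (↭-trans (↭-sym (∷↭∷ʳ e (X ++ Y))) e∷XY↭) e∈ ⟩
        retCost A e                     ≤⟨ retCost≤totalCost (X ++ e ∷ Y) P↭ ⟩
        totalCost ((X ++ e ∷ Y) ++ R)   ∎
        where open ≤-Reasoning

lemma4 : ∀ {n} (A : PartialAlg n) (e : Edge n) →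
    e ∈ edges (tour A) → e ∉ retired A →
    (∀ f → f ∈ edges (tour A) → f ∉ retired A → retCost A e ≤ retCost A f) →
    ∀ (c : ℕ) → IsCost A c ⇔ IsCostFrom (tour A) (retire A e) c
lemma4 A e e∈ e∉ cheapest c = mk⇔ to from
  where
  to : IsCost A c → IsCostFrom (tour A) (retire A e) c
  to ((L , r , refl) , least) =
    let L′ , r′ , L′≤L = retire-cheapest A e∈ e∉ cheapest r in
    (L′ , r′ , ≤-antisym L′≤L (least L′ (step e∈ e∉ r′))) ,
    λ L₂ r₂ → least L₂ (step e∈ e∉ r₂)
  from : IsCostFrom (tour A) (retire A e) c → IsCost A c
  from ((L , r , L≡c) , least) =
    (L , step e∈ e∉ r , L≡c) ,
    λ L₂ r₂ → let L′ , r′ , L′≤L₂ = retire-cheapest A e∈ e∉ cheapest r₂ in ≤-trans (least L′ r′) L′≤L₂
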